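{- For every positive matrix $A\in\mathbb{Z}^{r\times m}$, vector $\mathbf{b}\in\mathbb{Z}^r$ and integer $1\leq\ell\leq m$, the maximum $\ell$-degree of $\mathcal{S}_0(A,\mathbf{b},n)$ satisfies, as $n\to\infty$, $$\Delta_\ell(\mathcal{S}_0(A,\mathbf{b},n)) = O\left(\max_{Q\subseteq[m],\,|Q|=\ell} n^{(m-\mathrm{rk}(A)) - (|Q|-r_Q)}\right).$$
   Context: $S(A,\mathbf{b}) = \{\mathbf{x}\in\mathbb{Z}^m: A\mathbf{x}^T=\mathbf{b}^T\}$; $S_0(A,\mathbf{b})$ is its subset of vectors with pairwise distinct entries; $\mathcal{S}_0(A,\mathbf{b},n)$ is the hypergraph on vertex set $[n]$ with edges $\{x_1,\dots,x_m\}$ for $(x_1,\dots,x_m)\in S_0(A,\mathbf{b})\cap[n]^m$. For a hypergraph, $\Delta_\ell$ is the maximum, over $\ell$-sets $S$ of vertices, of the number of edges containing $S$. For $Q\subseteq[m]$, $A^Q$ is the submatrix of columns indexed by $Q$, $\bar Q = [m]\setminus Q$, the empty matrix has rank $0$, and $r_Q = \mathrm{rk}(A)-\mathrm{rk}(A^{\bar Q})$. $A$ is positive if $S(A,\mathbf{0})\cap\mathbb{N}^m\neq\emptyset$. -}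

module Defs where

open import Data.Nat as ℕ using (ℕ; zero; suc; _∸_; _⊔_; _≤_; _≟_)
open import Data.Integer as ℤ using (ℤ; +_)
open import Data.Fin using (Fin; toℕ; zero; suc)
open import Data.Fin.Subset using (Subset; inside; outside; _∈_; _∉_; _⊆_; ∣_∣; ∁; ⊤)
open import Data.Vec using (_∷_; [])
open import Data.List as List using (List; _++_; foldr; filter; length)
open import Data.List.Relation.Unary.All using (All)
open import Data.List.Relation.Unary.Unique.Propositional using (Unique)
open import Data.Product using (Σ; ∃; _×_)
open import Function.Bundles using (_⇔_)
open import Function.Definitions using (Injective)
open import Relation.Binary.PropositionalEquality using (_≡_)

Matrix : ℕ → ℕ → Set
Matrix r m = Fin r → Fin m → ℤ

sumFin : ∀ {m} → (Fin m → ℤ) → ℤ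
sumFin {zero}  f = + 0
sumFin {suc m} f = f zero ℤ.+ sumFin (λ j → f (suc j))

rowDot : ∀ {r m} → Matrix r m → (Fin m → ℤ) → Fin r → ℤ
rowDot A x i = sumFin (λ j → A i j ℤ.* x j)

Positive : ∀ {r m} → Matrix r m → Set
Positive {r} {m} A =
  Σ (Fin m → ℕ) λ x → (∀ j → 1 ≤ x j) × (∀ i → rowDot A (λ j → + x j) i ≡ + 0)

-- The columns of A indexed by U are linearly independent (over ℤ, equivalently ℚ).
Independent : ∀ {r m} → Matrix r m → Subset m → Set
Independent {r} {m} A U =
  (c : Fin m → ℤ) → (∀ j → j ∉ U → c j ≡ + 0) →
  (∀ i → rowDot A c i ≡ + 0) → ∀ j → c j ≡ + 0

-- IsRank A T k : k = rk(A^T) (column rank of the submatrix with columns in T;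
-- the empty matrix has rank 0).
IsRank : ∀ {r m} → Matrix r m → Subset m → ℕ → Set
IsRank {r} {m} A T k =
  (Σ (Subset m) λ U → U ⊆ T × Independent A U × ∣ U ∣ ≡ k) ×
  (∀ U → U ⊆ T → Independent A U → ∣ U ∣ ≤ k)

allSubsets : (m : ℕ) → List (Subset m)
allSubsets zero    = [] List.∷ List.[]
allSubsets (suc m) = List.map (inside ∷_) (allSubsets m) ++ List.map (outside ∷_) (allSubsets m)

-- Exponent (m - rk A) - (|Q| - r_Q), with r_Q = rk A - rk(A^{\bar Q});
-- rk is the rank function on column subsets.  All differences are nonnegative.
exponent : ∀ {m} → (Subset m → ℕ) → Subset m → ℕ
exponent {m} rk Q = (m ∸ rk ⊤) ∸ (∣ Q ∣ ∸ (rk ⊤ ∸ rk (∁ Q)))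

maxTerm : ∀ {m} → (Subset m → ℕ) → ℕ → ℕ → ℕ
maxTerm {m} rk ℓ n =
  foldr _⊔_ 0 (List.map (λ Q → n ℕ.^ exponent rk Q)
                        (filter (λ Q → ∣ Q ∣ ≟ ℓ) (allSubsets m)))

-- Vertex v : Fin n of the hypergraph stands for the integer toℕ v + 1 ∈ [n].
-- e is an edge of S₀(A,b,n): e = {x_1,...,x_m} for some x ∈ [n]^m with pairwise
-- distinct entries and A x^T = b^T.
IsEdge : ∀ {r m} → Matrix r m → (Fin r → ℤ) → (n : ℕ) → Subset n → Set
IsEdge {r} {m} A b n e =
  Σ (Fin m → Fin n) λ x →
    Injective _≡_ _≡_ x ×
    (∀ i → rowDot A (λ j → + suc (toℕ (x j))) i ≡ b i) ×
    (∀ v → (v ∈ e) ⇔ (∃ λ j → x j ≡ v))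

-- Δ_ℓ(S₀(A,b,n)) ≤ K : for every ℓ-set S of vertices, the number of edges
-- containing S is at most K (any list of pairwise distinct such edges has
-- length ≤ K).
MaxDegreeAtMost : ∀ {r m} → Matrix r m → (Fin r → ℤ) → (n ℓ K : ℕ) → Set
MaxDegreeAtMost A b n ℓ K =
  (S : Subset n) → ∣ S ∣ ≡ ℓ →
  (es : List (Subset n)) → Unique es →
  All (λ e → IsEdge A b n e × S ⊆ e) es → length es ≤ K

module Submission where

-- An edge through the ℓ-set S comes from an injective solution x of A x = b. Put Q = x⁻¹(S),
-- so |Q| = ℓ, and fix a basis U of the columns of A outside Q. Two solutions agreeing outside
-- U coincide, since their difference is a kernel vector supported on the independent set U.
-- So the edge is determined by Q and the entries of x outside U: those on Q lie in S, and the
-- remaining m − |Q| − rk(A^∁Q) entries lie in [n]. As rk(A^∁Q) ≤ rk A ≤ |Q| + rk(A^∁Q), this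
-- count of free entries is exactly (m − rk A) − (|Q| − r_Q). Counting the choices of Q and of
-- the recorded entries bounds the degree by 2^m ℓ^m times the largest of these powers of n.

open import Defs
open import Data.Nat using (ℕ; _≤_; _*_)
open import Data.Integer using (ℤ)
open import Data.Fin using (Fin)
open import Data.Fin.Subset using (Subset)
open import Data.Product using (Σ)

open import Data.Bool using (if_then_else_)
open import Data.Fin using (zero; suc; toℕ)
import Data.Fin.Properties as Fin
open import Data.Fin.Subset using (inside; outside; _∈_; _∉_; _⊆_; ∣_∣; ∁; _∩_; ⊤)
open import Data.Fin.Subset.Properties
  using (_∈?_; ∣p∣≤n; ∣∁p∣≡n∸∣p∣; ∣p∩q∣≤∣q∣; p⊆q⇒∣p∣≤∣q∣; p∩q⊆p; p∩q⊆q; x∈p∩q⁺; x∈p∩q⁻;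
         x∈∁p⇒x∉p; x∉p⇒x∈∁p; drop-there; ⊆⊤; ⊆-antisym)
import Data.Integer as ℤ
open import Data.Integer.Properties using (i-j≡0⇒i≡j; +-inverseʳ; +-injective)
open import Data.Integer.Solver using (module +-*-Solver)
open import Data.List using (List; []; _∷_; [_]; _++_; map; length; concatMap; filter; foldr; allFin;
                             cartesianProductWith)
open import Data.List.Properties using (length-map; length-++; length-filter; length-tabulate)
open import Data.List.Membership.Propositional using () renaming (_∈_ to _∈ₗ_)
open import Data.List.Membership.Propositional.Properties
  using (∈-map⁺; ∈-map⁻; ∈-++⁺ˡ; ∈-++⁺ʳ; ∈-∃++; ∈-allFin; ∈-filter⁺; ∈-filter⁻; ∈-concat⁺′;
         ∈-cartesianProductWith⁺)
open import Data.List.Relation.Binary.Permutation.Propositional.Properties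
  using (shift; ∈-resp-↭; ↭-length)
open import Data.List.Relation.Unary.All as All using (All)
open import Data.List.Relation.Unary.Any using () renaming (here to hereₗ; there to thereₗ)
open import Data.List.Relation.Unary.AllPairs using ([]; _∷_)
open import Data.List.Relation.Unary.Unique.Propositional using (Unique)
open import Data.List.Relation.Unary.Unique.Propositional.Properties using (map⁺)
open import Data.Maybe using (Maybe; just; nothing)
open import Data.Maybe.Properties using (just-injective)
open import Data.Nat as ℕ using (_+_; _∸_; _^_; _⊔_; _≟_; z≤n; s≤s; >-nonZero)
open import Data.Nat.Properties
  using (≤-refl; ≤-reflexive; ≤-trans; ≤-antisym; module ≤-Reasoning; +-mono-≤; *-mono-≤; *-monoˡ-≤;
         *-monoʳ-≤; ^-monoʳ-≤; +-assoc; +-comm; +-suc; +-identityʳ; *-assoc; ∸-+-assoc; m+[n∸m]≡n;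
         m+n∸m≡n; m≤n+o⇒m∸n≤o; m≤m⊔n; m≤n⊔m; suc-injective; *-commutativeSemigroup)
open import Algebra.Properties.CommutativeSemigroup *-commutativeSemigroup using (x∙yz≈y∙xz)
open import Data.Product using (_,_; proj₁; proj₂; ∃; _×_)
open import Data.Vec using (Vec; []; _∷_; lookup; tabulate; here; there)
open import Data.Vec.Properties using (lookup∘tabulate; []=⇒lookup; lookup⇒[]=)
open import Function using (_∘_)
open import Function.Bundles using (Equivalence; _⇔_)
open import Function.Definitions using (Injective)
open import Relation.Binary.PropositionalEquality
  using (_≡_; _≢_; refl; sym; trans; cong; cong₂; subst; module ≡-Reasoning)
open import Relation.Nullary using (yes; no; does; contradiction)

-- Counting by injections

injection⇒length≤ : {A B : Set} (R : A → B → Set) →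
                    (∀ {a a′ b} → R a b → R a′ b → a ≡ a′) →
                    ∀ {as bs} → Unique as → (∀ {a} → a ∈ₗ as → ∃ λ b → b ∈ₗ bs × R a b) →
                    length as ≤ length bs
injection⇒length≤ R R-leftUnique {[]} _ _ = z≤n
injection⇒length≤ R R-leftUnique {a ∷ as} (a∉as ∷ as-unique) image
  with b , b∈bs , Rab ← image (hereₗ refl)
  with bs₁ , bs₂ , refl ← ∈-∃++ b∈bs = begin
    1 + length as             ≤⟨ s≤s (injection⇒length≤ R R-leftUnique as-unique image′) ⟩
    1 + length (bs₁ ++ bs₂)   ≡⟨ ↭-length (shift b bs₁ bs₂) ⟨
    length (bs₁ ++ b ∷ bs₂)   ∎
  where
  open ≤-Reasoning
  image′ : ∀ {a′} → a′ ∈ₗ as → ∃ λ b′ → b′ ∈ₗ bs₁ ++ bs₂ × R a′ b′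
  image′ a′∈as with b′ , b′∈bs , Ra′b′ ← image (thereₗ a′∈as)
               with ∈-resp-↭ (shift b bs₁ bs₂) b′∈bs
  ... | hereₗ refl = contradiction (R-leftUnique Rab Ra′b′) (All.lookup a∉as a′∈as)
  ... | thereₗ b′∈ = b′ , b′∈ , Ra′b′

elements : ∀ {n} → Subset n → List (Fin n)
elements []            = []
elements (inside  ∷ p) = zero ∷ map suc (elements p)
elements (outside ∷ p) = map suc (elements p)

length-elements : ∀ {n} (p : Subset n) → length (elements p) ≡ ∣ p ∣
length-elements []            = refl
length-elements (inside  ∷ p) = cong ℕ.suc (trans (length-map suc (elements p)) (length-elements p))
length-elements (outside ∷ p) = trans (length-map suc (elements p)) (length-elements p)

∈-elements⁺ : ∀ {n} {p : Subset n} {i} → i ∈ p → i ∈ₗ elements p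
∈-elements⁺ {p = inside  ∷ p} here        = hereₗ refl
∈-elements⁺ {p = inside  ∷ p} (there i∈p) = thereₗ (∈-map⁺ suc (∈-elements⁺ i∈p))
∈-elements⁺ {p = outside ∷ p} (there i∈p) = ∈-map⁺ suc (∈-elements⁺ i∈p)

∈-elements⁻ : ∀ {n} (p : Subset n) {i} → i ∈ₗ elements p → i ∈ p
∈-elements⁻ (inside ∷ p) (hereₗ refl) = here
∈-elements⁻ (inside ∷ p) (thereₗ i∈)
  with _ , i′∈ , refl ← ∈-map⁻ suc i∈ = there (∈-elements⁻ p i′∈)
∈-elements⁻ (outside ∷ p) i∈
  with _ , i′∈ , refl ← ∈-map⁻ suc i∈ = there (∈-elements⁻ p i′∈)

elements-unique : ∀ {n} (p : Subset n) → Unique (elements p)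
elements-unique []            = []
elements-unique (inside  ∷ p) = All.tabulate zero∉ ∷ map⁺ Fin.suc-injective (elements-unique p)
  where
  zero∉ : ∀ {i} → i ∈ₗ map suc (elements p) → zero ≢ i
  zero∉ i∈ refl with ∈-map⁻ suc i∈
  ... | _ , _ , ()
elements-unique (outside ∷ p) = map⁺ Fin.suc-injective (elements-unique p)

injection⇒∣p∣≤∣q∣ : ∀ {m n} {p : Subset m} {q : Subset n} (R : Fin m → Fin n → Set) →
                    (∀ {i i′ j} → R i j → R i′ j → i ≡ i′) →
                    (∀ {i} → i ∈ p → ∃ λ j → j ∈ q × R i j) → ∣ p ∣ ≤ ∣ q ∣
injection⇒∣p∣≤∣q∣ {p = p} {q} R R-leftUnique image = begin
  ∣ p ∣               ≡⟨ length-elements p ⟨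
  length (elements p) ≤⟨ injection⇒length≤ R R-leftUnique (elements-unique p) image′ ⟩
  length (elements q) ≡⟨ length-elements q ⟩
  ∣ q ∣               ∎
  where
  open ≤-Reasoning
  image′ : ∀ {i} → i ∈ₗ elements p → ∃ λ j → j ∈ₗ elements q × R i j
  image′ i∈ with j , j∈q , Rij ← image (∈-elements⁻ p i∈) = j , ∈-elements⁺ j∈q , Rij

preimage : ∀ {m n} → (Fin m → Fin n) → Subset n → Subset m
preimage x S = tabulate (λ j → lookup S (x j))

∈-preimage⁺ : ∀ {m n} {x : Fin m → Fin n} {S j} → x j ∈ S → j ∈ preimage x S
∈-preimage⁺ {x = x} {S} {j} xj∈S =
  lookup⇒[]= j _ (trans (lookup∘tabulate (λ j → lookup S (x j)) j) ([]=⇒lookup xj∈S))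

∈-preimage⁻ : ∀ {m n} {x : Fin m → Fin n} {S j} → j ∈ preimage x S → x j ∈ S
∈-preimage⁻ {x = x} {S} {j} j∈ =
  lookup⇒[]= (x j) S (trans (sym (lookup∘tabulate (λ j → lookup S (x j)) j)) ([]=⇒lookup j∈))

∣preimage∣≡∣S∣ : ∀ {m n} {x : Fin m → Fin n} {S} → Injective _≡_ _≡_ x →
                 (∀ {v} → v ∈ S → ∃ λ j → x j ≡ v) → ∣ preimage x S ∣ ≡ ∣ S ∣
∣preimage∣≡∣S∣ {x = x} {S} x-injective S⊆image = ≤-antisym
  (injection⇒∣p∣≤∣q∣ (λ j v → x j ≡ v) (λ xj≡v xj′≡v → x-injective (trans xj≡v (sym xj′≡v)))
                     (λ {j} j∈ → x j , ∈-preimage⁻ {S = S} j∈ , refl))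
  (injection⇒∣p∣≤∣q∣ (λ v j → x j ≡ v) (λ xj≡v xj≡v′ → trans (sym xj≡v) xj≡v′) covered)
  where
  covered : ∀ {v} → v ∈ S → ∃ λ j → j ∈ preimage x S × x j ≡ v
  covered v∈S with j , refl ← S⊆image v∈S = j , ∈-preimage⁺ v∈S , refl

∣p∣≡∣p∩q∣+∣p∩∁q∣ : ∀ {n} (p q : Subset n) → ∣ p ∣ ≡ ∣ p ∩ q ∣ + ∣ p ∩ ∁ q ∣
∣p∣≡∣p∩q∣+∣p∩∁q∣ []            []            = refl
∣p∣≡∣p∩q∣+∣p∩∁q∣ (inside  ∷ p) (inside  ∷ q) = cong ℕ.suc (∣p∣≡∣p∩q∣+∣p∩∁q∣ p q)
∣p∣≡∣p∩q∣+∣p∩∁q∣ (inside  ∷ p) (outside ∷ q) =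
  trans (cong ℕ.suc (∣p∣≡∣p∩q∣+∣p∩∁q∣ p q)) (sym (+-suc _ _))
∣p∣≡∣p∩q∣+∣p∩∁q∣ (outside ∷ p) (_       ∷ q) = ∣p∣≡∣p∩q∣+∣p∩∁q∣ p q

∣p∩∁q∣≡∣p∣∸∣q∣ : ∀ {n} {p q : Subset n} → q ⊆ p → ∣ p ∩ ∁ q ∣ ≡ ∣ p ∣ ∸ ∣ q ∣
∣p∩∁q∣≡∣p∣∸∣q∣ {p = p} {q} q⊆p = begin
  ∣ p ∩ ∁ q ∣                           ≡⟨ m+n∸m≡n ∣ p ∩ q ∣ _ ⟨
  ∣ p ∩ q ∣ + ∣ p ∩ ∁ q ∣ ∸ ∣ p ∩ q ∣   ≡⟨ cong₂ _∸_ (sym (∣p∣≡∣p∩q∣+∣p∩∁q∣ p q)) ∣p∩q∣≡∣q∣ ⟩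
  ∣ p ∣ ∸ ∣ q ∣                         ∎
  where
  open ≡-Reasoning
  ∣p∩q∣≡∣q∣ : ∣ p ∩ q ∣ ≡ ∣ q ∣
  ∣p∩q∣≡∣q∣ = ≤-antisym (∣p∩q∣≤∣q∣ p q) (p⊆q⇒∣p∣≤∣q∣ (λ i∈q → x∈p∩q⁺ (q⊆p i∈q , i∈q)))

-- Vectors with prescribed coordinate lists

length-cartesianProductWith : ∀ {A B C : Set} (f : A → B → C) xs ys →
  length (cartesianProductWith f xs ys) ≡ length xs * length ys
length-cartesianProductWith f []       ys = refl
length-cartesianProductWith f (x ∷ xs) ys =
  trans (length-++ (map (f x) ys)) (cong₂ _+_ (length-map (f x) ys) (length-cartesianProductWith f xs ys))

choices : ∀ {A : Set} {m} → (Fin m → List A) → List (Vec A m)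
choices {m = ℕ.zero}  L = [ [] ]
choices {m = ℕ.suc m} L = cartesianProductWith _∷_ (L zero) (choices (L ∘ suc))

∈-choices : ∀ {A : Set} {m} {L : Fin m → List A} {f : Fin m → A} →
            (∀ i → f i ∈ₗ L i) → tabulate f ∈ₗ choices L
∈-choices {m = ℕ.zero}  _   = hereₗ refl
∈-choices {m = ℕ.suc m} f∈L = ∈-cartesianProductWith⁺ _∷_ (f∈L zero) (∈-choices (f∈L ∘ suc))

length-choices≤ : ∀ {A : Set} {m} (L : Fin m → List A) (F : Subset m) {k n} →
                  (∀ {i} → i ∈ F → length (L i) ≤ n) → (∀ {i} → i ∉ F → length (L i) ≤ k) →
                  length (choices L) ≤ k ^ ∣ ∁ F ∣ * n ^ ∣ F ∣
length-choices≤ L [] _ _ = ≤-refl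
length-choices≤ L (inside ∷ F) {k} {n} in-F out-F = begin
  length (choices L)                           ≡⟨ length-cartesianProductWith _ (L zero) _ ⟩
  length (L zero) * length (choices (L ∘ suc)) ≤⟨ *-mono-≤ (in-F here) tail≤ ⟩
  n * (k ^ ∣ ∁ F ∣ * n ^ ∣ F ∣)                ≡⟨ x∙yz≈y∙xz n (k ^ ∣ ∁ F ∣) (n ^ ∣ F ∣) ⟩
  k ^ ∣ ∁ F ∣ * (n * n ^ ∣ F ∣)                ∎
  where
  open ≤-Reasoning
  tail≤ : length (choices (L ∘ suc)) ≤ k ^ ∣ ∁ F ∣ * n ^ ∣ F ∣
  tail≤ = length-choices≤ (L ∘ suc) F (in-F ∘ there) (out-F ∘ (_∘ drop-there))
length-choices≤ L (outside ∷ F) {k} {n} in-F out-F = begin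
  length (choices L)                           ≡⟨ length-cartesianProductWith _ (L zero) _ ⟩
  length (L zero) * length (choices (L ∘ suc)) ≤⟨ *-mono-≤ (out-F λ ()) tail≤ ⟩
  k * (k ^ ∣ ∁ F ∣ * n ^ ∣ F ∣)                ≡⟨ *-assoc k _ _ ⟨
  k * k ^ ∣ ∁ F ∣ * n ^ ∣ F ∣                  ∎
  where
  open ≤-Reasoning
  tail≤ : length (choices (L ∘ suc)) ≤ k ^ ∣ ∁ F ∣ * n ^ ∣ F ∣
  tail≤ = length-choices≤ (L ∘ suc) F (in-F ∘ there) (out-F ∘ (_∘ drop-there))

length-concatMap≤ : ∀ {A B : Set} (f : A → List B) (xs : List A) {k} →
                    (∀ {x} → x ∈ₗ xs → length (f x) ≤ k) → length (concatMap f xs) ≤ length xs * k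
length-concatMap≤ f []       _ = z≤n
length-concatMap≤ f (x ∷ xs) {k} f≤k = begin
  length (f x ++ concatMap f xs)         ≡⟨ length-++ (f x) ⟩
  length (f x) + length (concatMap f xs) ≤⟨ +-mono-≤ (f≤k (hereₗ refl)) (length-concatMap≤ f xs (f≤k ∘ thereₗ)) ⟩
  k + length xs * k                      ∎
  where open ≤-Reasoning

-- Linear algebra over ℤ

sumFin-sub : ∀ {m} (f g : Fin m → ℤ) → sumFin (λ j → f j ℤ.- g j) ≡ sumFin f ℤ.- sumFin g
sumFin-sub {ℕ.zero}  f g = refl
sumFin-sub {ℕ.suc m} f g = begin
  (f zero ℤ.- g zero) ℤ.+ sumFin (λ j → f (suc j) ℤ.- g (suc j))
    ≡⟨ cong (λ t → (f zero ℤ.- g zero) ℤ.+ t) (sumFin-sub (f ∘ suc) (g ∘ suc)) ⟩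
  (f zero ℤ.- g zero) ℤ.+ (sumFin (f ∘ suc) ℤ.- sumFin (g ∘ suc))
    ≡⟨ solve 4 (λ a b c d → (a :- b) :+ (c :- d) := (a :+ c) :- (b :+ d)) refl
               (f zero) (g zero) (sumFin (f ∘ suc)) (sumFin (g ∘ suc)) ⟩
  (f zero ℤ.+ sumFin (f ∘ suc)) ℤ.- (g zero ℤ.+ sumFin (g ∘ suc)) ∎
  where
  open ≡-Reasoning
  open +-*-Solver

sumFin-cong : ∀ {m} {f g : Fin m → ℤ} → (∀ j → f j ≡ g j) → sumFin f ≡ sumFin g
sumFin-cong {ℕ.zero}  _   = refl
sumFin-cong {ℕ.suc m} f≗g = cong₂ ℤ._+_ (f≗g zero) (sumFin-cong (f≗g ∘ suc))

rowDot-sub : ∀ {r m} (A : Matrix r m) (f g : Fin m → ℤ) i →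
             rowDot A (λ j → f j ℤ.- g j) i ≡ rowDot A f i ℤ.- rowDot A g i
rowDot-sub A f g i = trans (sumFin-cong distrib) (sumFin-sub (λ j → A i j ℤ.* f j) (λ j → A i j ℤ.* g j))
  where
  open +-*-Solver
  distrib : ∀ j → A i j ℤ.* (f j ℤ.- g j) ≡ A i j ℤ.* f j ℤ.- A i j ℤ.* g j
  distrib j = solve 3 (λ a x y → a :* (x :- y) := a :* x :- a :* y) refl (A i j) (f j) (g j)

independent-⊆ : ∀ {r m} {A : Matrix r m} {V W} → V ⊆ W → Independent A W → Independent A V
independent-⊆ V⊆W W-independent c c-off-V Ac≡0 =
  W-independent c (λ j j∉W → c-off-V j (j∉W ∘ V⊆W)) Ac≡0

independent⇒≗ : ∀ {r m} {A : Matrix r m} {U} {f g : Fin m → ℤ} → Independent A U →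
                (∀ i → rowDot A f i ≡ rowDot A g i) → (∀ j → j ∉ U → f j ≡ g j) →
                ∀ j → f j ≡ g j
independent⇒≗ {A = A} {U} {f} {g} U-independent Af≡Ag f≡g-off-U j =
  i-j≡0⇒i≡j (f j) (g j) (U-independent (λ j → f j ℤ.- g j) f-g-off-U A[f-g]≡0 j)
  where
  f-g-off-U : ∀ j → j ∉ U → f j ℤ.- g j ≡ ℤ.+ 0
  f-g-off-U j j∉U = trans (cong (ℤ._- g j) (f≡g-off-U j j∉U)) (+-inverseʳ (g j))
  A[f-g]≡0 : ∀ i → rowDot A (λ j → f j ℤ.- g j) i ≡ ℤ.+ 0
  A[f-g]≡0 i = trans (rowDot-sub A f g i) (trans (cong (ℤ._- rowDot A g i) (Af≡Ag i)) (+-inverseʳ (rowDot A g i)))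

-- Ranks and the exponent

m∸r∸[q∸[r∸s]]≡m∸q∸s : ∀ m {q r s} → s ≤ r → r ≤ q + s → m ∸ r ∸ (q ∸ (r ∸ s)) ≡ m ∸ q ∸ s
m∸r∸[q∸[r∸s]]≡m∸q∸s m {q} {r} {s} s≤r r≤q+s = begin
  m ∸ r ∸ (q ∸ d)           ≡⟨ ∸-+-assoc m r (q ∸ d) ⟩
  m ∸ (r + (q ∸ d))         ≡⟨ cong (λ t → m ∸ (t + (q ∸ d))) (m+[n∸m]≡n s≤r) ⟨
  m ∸ (s + d + (q ∸ d))     ≡⟨ cong (m ∸_) (+-assoc s d (q ∸ d)) ⟩
  m ∸ (s + (d + (q ∸ d)))   ≡⟨ cong (λ t → m ∸ (s + t)) (m+[n∸m]≡n d≤q) ⟩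
  m ∸ (s + q)               ≡⟨ cong (m ∸_) (+-comm s q) ⟩
  m ∸ (q + s)               ≡⟨ ∸-+-assoc m q s ⟨
  m ∸ q ∸ s                 ∎
  where
  open ≡-Reasoning
  d : ℕ
  d = r ∸ s
  d≤q : d ≤ q
  d≤q = m≤n+o⇒m∸n≤o r s (subst (r ≤_) (+-comm q s) r≤q+s)

module Rank {r m} (A : Matrix r m) {rk : Subset m → ℕ} (isRank : ∀ T → IsRank A T (rk T)) where

  basis : Subset m → Subset m
  basis T = proj₁ (proj₁ (isRank T))

  basis⊆ : ∀ T → basis T ⊆ T
  basis⊆ T = proj₁ (proj₂ (proj₁ (isRank T)))

  basis-independent : ∀ T → Independent A (basis T)
  basis-independent T = proj₁ (proj₂ (proj₂ (proj₁ (isRank T))))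

  ∣basis∣≡rk : ∀ T → ∣ basis T ∣ ≡ rk T
  ∣basis∣≡rk T = proj₂ (proj₂ (proj₂ (proj₁ (isRank T))))

  independent⇒∣U∣≤rk : ∀ {U T} → U ⊆ T → Independent A U → ∣ U ∣ ≤ rk T
  independent⇒∣U∣≤rk {U} {T} = proj₂ (isRank T) U

  rk-mono : ∀ {T T′} → T ⊆ T′ → rk T ≤ rk T′
  rk-mono {T} T⊆T′ = subst (_≤ _) (∣basis∣≡rk T)
    (independent⇒∣U∣≤rk (T⊆T′ ∘ basis⊆ T) (basis-independent T))

  rk⊤≤∣Q∣+rk∁Q : ∀ Q → rk ⊤ ≤ ∣ Q ∣ + rk (∁ Q)
  rk⊤≤∣Q∣+rk∁Q Q = begin
    rk ⊤                      ≡⟨ ∣basis∣≡rk ⊤ ⟨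
    ∣ B ∣                     ≡⟨ ∣p∣≡∣p∩q∣+∣p∩∁q∣ B Q ⟩
    ∣ B ∩ Q ∣ + ∣ B ∩ ∁ Q ∣   ≤⟨ +-mono-≤ (∣p∩q∣≤∣q∣ B Q) (independent⇒∣U∣≤rk (p∩q⊆q B (∁ Q)) B∩∁Q-independent) ⟩
    ∣ Q ∣ + rk (∁ Q)          ∎
    where
    open ≤-Reasoning
    B : Subset m
    B = basis ⊤
    B∩∁Q-independent : Independent A (B ∩ ∁ Q)
    B∩∁Q-independent = independent-⊆ {A = A} (p∩q⊆p B (∁ Q)) (basis-independent ⊤)

  free : Subset m → Subset m
  free Q = ∁ Q ∩ ∁ (basis (∁ Q))

  ∣free∣≡exponent : ∀ Q → ∣ free Q ∣ ≡ exponent rk Q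
  ∣free∣≡exponent Q = begin
    ∣ ∁ Q ∩ ∁ (basis (∁ Q)) ∣       ≡⟨ ∣p∩∁q∣≡∣p∣∸∣q∣ (basis⊆ (∁ Q)) ⟩
    ∣ ∁ Q ∣ ∸ ∣ basis (∁ Q) ∣       ≡⟨ cong₂ _∸_ (∣∁p∣≡n∸∣p∣ Q) (∣basis∣≡rk (∁ Q)) ⟩
    m ∸ ∣ Q ∣ ∸ rk (∁ Q)             ≡⟨ m∸r∸[q∸[r∸s]]≡m∸q∸s m (rk-mono ⊆⊤) (rk⊤≤∣Q∣+rk∁Q Q) ⟨
    exponent rk Q                    ∎
    where open ≡-Reasoning

subsetsOfSize : ∀ m → ℕ → List (Subset m)
subsetsOfSize m ℓ = filter (λ Q → ∣ Q ∣ ≟ ℓ) (allSubsets m)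

∈-allSubsets : ∀ {m} (Q : Subset m) → Q ∈ₗ allSubsets m
∈-allSubsets []                    = hereₗ refl
∈-allSubsets (inside ∷ Q)          = ∈-++⁺ˡ (∈-map⁺ (inside ∷_) (∈-allSubsets Q))
∈-allSubsets {ℕ.suc m} (outside ∷ Q) =
  ∈-++⁺ʳ (map (inside ∷_) (allSubsets m)) (∈-map⁺ (outside ∷_) (∈-allSubsets Q))

length-allSubsets : ∀ m → length (allSubsets m) ≡ 2 ^ m
length-allSubsets ℕ.zero    = refl
length-allSubsets (ℕ.suc m) = begin
  length (map (inside ∷_) Qs ++ map (outside ∷_) Qs)          ≡⟨ length-++ (map (inside ∷_) Qs) ⟩
  length (map (inside ∷_) Qs) + length (map (outside ∷_) Qs)  ≡⟨ cong₂ _+_ (length-map _ Qs) (length-map _ Qs) ⟩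
  length Qs + length Qs                                       ≡⟨ cong (λ t → t + t) (length-allSubsets m) ⟩
  2 ^ m + 2 ^ m                                               ≡⟨ cong (2 ^ m +_) (+-identityʳ (2 ^ m)) ⟨
  2 ^ ℕ.suc m                                                 ∎
  where
  open ≡-Reasoning
  Qs = allSubsets m

∈-subsetsOfSize⁺ : ∀ {m ℓ} {Q : Subset m} → ∣ Q ∣ ≡ ℓ → Q ∈ₗ subsetsOfSize m ℓ
∈-subsetsOfSize⁺ {ℓ = ℓ} {Q} = ∈-filter⁺ (λ Q → ∣ Q ∣ ≟ ℓ) (∈-allSubsets Q)

∈-subsetsOfSize⁻ : ∀ {m ℓ} {Q : Subset m} → Q ∈ₗ subsetsOfSize m ℓ → ∣ Q ∣ ≡ ℓ
∈-subsetsOfSize⁻ {m} {ℓ} = proj₂ ∘ ∈-filter⁻ (λ Q → ∣ Q ∣ ≟ ℓ) {xs = allSubsets m}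

length-subsetsOfSize≤ : ∀ m ℓ → length (subsetsOfSize m ℓ) ≤ 2 ^ m
length-subsetsOfSize≤ m ℓ =
  ≤-trans (length-filter (λ Q → ∣ Q ∣ ≟ ℓ) (allSubsets m)) (≤-reflexive (length-allSubsets m))

∈⇒≤foldr-⊔ : ∀ {x xs} → x ∈ₗ xs → x ≤ foldr _⊔_ 0 xs
∈⇒≤foldr-⊔ {xs = y ∷ _} (hereₗ refl)  = m≤m⊔n y _
∈⇒≤foldr-⊔ {xs = y ∷ _} (thereₗ x∈ys) = ≤-trans (∈⇒≤foldr-⊔ x∈ys) (m≤n⊔m y _)

term≤maxTerm : ∀ {m} (rk : Subset m → ℕ) {ℓ} n {Q} → ∣ Q ∣ ≡ ℓ → n ^ exponent rk Q ≤ maxTerm rk ℓ n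
term≤maxTerm rk n ∣Q∣≡ℓ = ∈⇒≤foldr-⊔ (∈-map⁺ (λ Q → n ^ exponent rk Q) (∈-subsetsOfSize⁺ ∣Q∣≡ℓ))

-- Coding the edges through a fixed vertex set

module EdgeCoding {r m} (A : Matrix r m) (b : Fin r → ℤ) {rk : Subset m → ℕ}
                  (isRank : ∀ T → IsRank A T (rk T)) {n} (S : Subset n) where

  open Rank A isRank

  erase : Subset m → (Fin m → Fin n) → Vec (Maybe (Fin n)) m
  erase U x = tabulate λ j → if does (j ∈? U) then nothing else just (x j)

  erase-injective : ∀ {U x x′ j} → erase U x ≡ erase U x′ → j ∉ U → x j ≡ x′ j
  erase-injective {U} {x} {x′} {j} erase≡ j∉U
    with j ∈? U
       | trans (sym (lookup∘tabulate _ j)) (trans (cong (λ v → lookup v j) erase≡) (lookup∘tabulate _ j))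
  ... | yes j∈U | _         = contradiction j∈U j∉U
  ... | no _    | just≡just = just-injective just≡just

  allowed : Subset m → Fin m → List (Maybe (Fin n))
  allowed Q j with j ∈? basis (∁ Q) | j ∈? Q
  ... | yes _ | _     = [ nothing ]
  ... | no _  | yes _ = map just (elements S)
  ... | no _  | no _  = map just (allFin n)

  erase∈choices : ∀ {Q} x → (∀ {j} → j ∈ Q → x j ∈ S) → erase (basis (∁ Q)) x ∈ₗ choices (allowed Q)
  erase∈choices {Q} x xQ⊆S = ∈-choices entry∈allowed
    where
    entry∈allowed : ∀ j → (if does (j ∈? basis (∁ Q)) then nothing else just (x j)) ∈ₗ allowed Q j
    entry∈allowed j with j ∈? basis (∁ Q) | j ∈? Q
    ... | yes _ | _       = hereₗ refl
    ... | no _  | yes j∈Q = ∈-map⁺ just (∈-elements⁺ (xQ⊆S j∈Q))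
    ... | no _  | no _    = ∈-map⁺ just (∈-allFin (x j))

  length-choices-allowed : ∀ Q → 1 ≤ ∣ S ∣ → length (choices (allowed Q)) ≤ ∣ S ∣ ^ m * n ^ exponent rk Q
  length-choices-allowed Q 1≤∣S∣ = begin
    length (choices (allowed Q))             ≤⟨ length-choices≤ (allowed Q) (free Q) on-free off-free ⟩
    ∣ S ∣ ^ ∣ ∁ (free Q) ∣ * n ^ ∣ free Q ∣  ≤⟨ *-monoˡ-≤ _ (^-monoʳ-≤ ∣ S ∣ {{>-nonZero 1≤∣S∣}} (∣p∣≤n (∁ (free Q)))) ⟩
    ∣ S ∣ ^ m * n ^ ∣ free Q ∣               ≡⟨ cong (λ t → ∣ S ∣ ^ m * n ^ t) (∣free∣≡exponent Q) ⟩
    ∣ S ∣ ^ m * n ^ exponent rk Q            ∎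
    where
    open ≤-Reasoning
    on-free : ∀ {j} → j ∈ free Q → length (allowed Q j) ≤ n
    on-free {j} j∈free with x∈p∩q⁻ (∁ Q) _ j∈free
    ... | j∈∁Q , j∈∁U with j ∈? basis (∁ Q) | j ∈? Q
    ... | yes j∈U | _       = contradiction j∈U (x∈∁p⇒x∉p j∈∁U)
    ... | no _    | yes j∈Q = contradiction j∈Q (x∈∁p⇒x∉p j∈∁Q)
    ... | no _    | no _    = ≤-reflexive (trans (length-map just (allFin n)) (length-tabulate (λ i → i)))
    off-free : ∀ {j} → j ∉ free Q → length (allowed Q j) ≤ ∣ S ∣
    off-free {j} j∉free with j ∈? basis (∁ Q) | j ∈? Q
    ... | yes _   | _       = 1≤∣S∣
    ... | no _    | yes _   = ≤-reflexive (trans (length-map just (elements S)) (length-elements S))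
    ... | no j∉U  | no j∉Q  = contradiction (x∈p∩q⁺ (x∉p⇒x∈∁p j∉Q , x∉p⇒x∈∁p j∉U)) j∉free

  Code : Set
  Code = Subset m × Vec (Maybe (Fin n)) m

  code : ∀ {e} → IsEdge A b n e → Code
  code (x , _) = preimage x S , erase (basis (∁ (preimage x S))) x

  codes : List Code
  codes = concatMap (λ Q → map (Q ,_) (choices (allowed Q))) (subsetsOfSize m ∣ S ∣)

  code∈codes : ∀ {e} (w : IsEdge A b n e) → S ⊆ e → code w ∈ₗ codes
  code∈codes (x , x-injective , _ , e≈image) S⊆e =
    ∈-concat⁺′ (∈-map⁺ (Q ,_) (erase∈choices x (∈-preimage⁻ {S = S})))
               (∈-map⁺ (λ Q → map (Q ,_) (choices (allowed Q))) (∈-subsetsOfSize⁺ ∣Q∣≡∣S∣))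
    where
    Q : Subset m
    Q = preimage x S
    ∣Q∣≡∣S∣ : ∣ Q ∣ ≡ ∣ S ∣
    ∣Q∣≡∣S∣ = ∣preimage∣≡∣S∣ x-injective (λ {v} v∈S → Equivalence.to (e≈image v) (S⊆e v∈S))

  code-injective : ∀ {e e′} (w : IsEdge A b n e) (w′ : IsEdge A b n e′) → code w ≡ code w′ → e ≡ e′
  code-injective (x , _ , Ax≡b , e≈image) (x′ , _ , Ax′≡b , e′≈image) code≡ =
    ⊆-antisym (⊆-image e≈image e′≈image x≗x′) (⊆-image e′≈image e≈image (sym ∘ x≗x′))
    where
    U : Subset m
    U = basis (∁ (preimage x S))
    erase≡ : erase U x ≡ erase U x′
    erase≡ = trans (cong proj₂ code≡) (cong (λ Q → erase (basis (∁ Q)) x′) (sym (cong proj₁ code≡)))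
    X≗X′ : ∀ j → ℤ.+ ℕ.suc (toℕ (x j)) ≡ ℤ.+ ℕ.suc (toℕ (x′ j))
    X≗X′ = independent⇒≗ {A = A} (basis-independent (∁ (preimage x S)))
      (λ i → trans (Ax≡b i) (sym (Ax′≡b i)))
      (λ j j∉U → cong (λ v → ℤ.+ ℕ.suc (toℕ v)) (erase-injective erase≡ j∉U))
    x≗x′ : ∀ j → x j ≡ x′ j
    x≗x′ j = Fin.toℕ-injective (suc-injective (+-injective (X≗X′ j)))
    ⊆-image : ∀ {f f′ : Subset n} {y y′ : Fin m → Fin n} →
              (∀ v → v ∈ f ⇔ ∃ λ j → y j ≡ v) → (∀ v → v ∈ f′ ⇔ ∃ λ j → y′ j ≡ v) →
              (∀ j → y j ≡ y′ j) → f ⊆ f′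
    ⊆-image f≈image f′≈image y≗y′ {v} v∈f with j , yj≡v ← Equivalence.to (f≈image v) v∈f =
      Equivalence.from (f′≈image v) (j , trans (sym (y≗y′ j)) yj≡v)

  length-codes : 1 ≤ ∣ S ∣ → length codes ≤ 2 ^ m * ∣ S ∣ ^ m * maxTerm rk ∣ S ∣ n
  length-codes 1≤∣S∣ = begin
    length codes                                       ≤⟨ length-concatMap≤ _ (subsetsOfSize m ∣ S ∣) length-codesOf ⟩
    length (subsetsOfSize m ∣ S ∣) * (∣ S ∣ ^ m * K)   ≤⟨ *-monoˡ-≤ _ (length-subsetsOfSize≤ m ∣ S ∣) ⟩
    2 ^ m * (∣ S ∣ ^ m * K)                            ≡⟨ *-assoc (2 ^ m) _ _ ⟨
    2 ^ m * ∣ S ∣ ^ m * K                              ∎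
    where
    open ≤-Reasoning
    K : ℕ
    K = maxTerm rk ∣ S ∣ n
    length-codesOf : ∀ {Q} → Q ∈ₗ subsetsOfSize m ∣ S ∣ → length (map (Q ,_) (choices (allowed Q))) ≤ ∣ S ∣ ^ m * K
    length-codesOf {Q} Q∈ = begin
      length (map (Q ,_) (choices (allowed Q)))  ≡⟨ length-map (Q ,_) (choices (allowed Q)) ⟩
      length (choices (allowed Q))               ≤⟨ length-choices-allowed Q 1≤∣S∣ ⟩
      ∣ S ∣ ^ m * n ^ exponent rk Q              ≤⟨ *-monoʳ-≤ (∣ S ∣ ^ m) (term≤maxTerm rk n {Q} (∈-subsetsOfSize⁻ Q∈)) ⟩
      ∣ S ∣ ^ m * K                              ∎

  edges⊇S-length≤ : ∀ {es} → Unique es → All (λ e → IsEdge A b n e × S ⊆ e) es → length es ≤ length codes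
  edges⊇S-length≤ {es} es-unique es⊇S = injection⇒length≤ HasCode HasCode-leftUnique es-unique coded
    where
    HasCode : Subset n → Code → Set
    HasCode e c = Σ (IsEdge A b n e) λ w → code w ≡ c
    HasCode-leftUnique : ∀ {e e′ c} → HasCode e c → HasCode e′ c → e ≡ e′
    HasCode-leftUnique (w , refl) (w′ , c≡) = code-injective w w′ (sym c≡)
    coded : ∀ {e} → e ∈ₗ es → ∃ λ c → c ∈ₗ codes × HasCode e c
    coded e∈es with w , S⊆e ← All.lookup es⊇S e∈es = code w , code∈codes w S⊆e , w , refl

maxDegree≤ : ∀ {r m} (A : Matrix r m) (b : Fin r → ℤ) {rk : Subset m → ℕ} →
             (∀ T → IsRank A T (rk T)) → ∀ {ℓ} → 1 ≤ ℓ → ∀ n →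
             MaxDegreeAtMost A b n ℓ (2 ^ m * ℓ ^ m * maxTerm rk ℓ n)
maxDegree≤ A b isRank 1≤ℓ n S refl es es-unique es⊇S =
  ≤-trans (edges⊇S-length≤ es-unique es⊇S) (length-codes 1≤ℓ)
  where open EdgeCoding A b isRank S

lemma4p6 : (r m : ℕ) (A : Matrix r m) (b : Fin r → ℤ) (ℓ : ℕ) →
    Positive A → 1 ≤ ℓ → ℓ ≤ m →
    (rk : Subset m → ℕ) → (∀ T → IsRank A T (rk T)) →
    Σ ℕ λ C → Σ ℕ λ N → (n : ℕ) → N ≤ n →
      MaxDegreeAtMost A b n ℓ (C * maxTerm rk ℓ n)
lemma4p6 _ m A b ℓ _ 1≤ℓ _ _ isRank = 2 ^ m * ℓ ^ m , 0 , λ n _ → maxDegree≤ A b isRank 1≤ℓ n
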